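{- Suppose that every bridgeless cubic graph admits a Petersen coloring (the Petersen Coloring Conjecture). Then every bridgeless cubic graph $G$ admits a list $(E_0,E_1,E_2,E_3,E_4)$ of five even subgraphs such that every edge of $G$ belongs to exactly two of them and $|E_0|\geq \frac{3}{5}|E(G)|$.
   Context: Graphs are finite and loopless but may have parallel edges. A cubic graph is one in which every vertex has degree $3$. An even subgraph is (the edge set of) a subgraph in which every vertex has even degree (possibly empty). For a vertex $v$ of a graph $G$, $\partial_G(v)$ denotes the set of edges incident to $v$. For cubic graphs $G,H$, an $H$-coloring of $G$ is a map $\phi:E(G)\to E(H)$ such that for every $v\in V(G)$ there is $w\in V(H)$ with $\phi(\partial_G(v))=\partial_H(w)$. A Petersen coloring of $G$ is a $P_{10}$-coloring of $G$, where $P_{10}$ is the Petersen graph. -}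

module Defs where

open import Data.Nat using (ℕ; zero; suc; _+_; _*_; _≤_)
open import Data.Fin using (Fin; zero; suc; _≟_; #_)
open import Data.Bool using (Bool; true; false; if_then_else_; _∧_; _∨_)
open import Data.Product using (_×_; _,_; proj₁; proj₂; ∃; Σ)
open import Data.Sum using (_⊎_)
open import Relation.Binary.PropositionalEquality using (_≡_; _≢_)
open import Relation.Nullary.Decidable using (⌊_⌋)
open import Relation.Nullary using (¬_)

record Graph : Set where
  field
    n    : ℕ
    m    : ℕ
    ends : Fin m → Fin n × Fin n
    loopless : ∀ e → proj₁ (ends e) ≢ proj₂ (ends e)
open Graph public

V : Graph → Set
V G = Fin (n G)

E : Graph → Set
E G = Fin (m G)

Incident : (G : Graph) → V G → E G → Set
Incident G v e = (proj₁ (ends G e) ≡ v) ⊎ (proj₂ (ends G e) ≡ v)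

incidentᵇ : (G : Graph) → V G → E G → Bool
incidentᵇ G v e = ⌊ proj₁ (ends G e) ≟ v ⌋ ∨ ⌊ proj₂ (ends G e) ≟ v ⌋

count : ∀ {k} → (Fin k → Bool) → ℕ
count {zero}  f = 0
count {suc k} f = (if f zero then 1 else 0) + count (λ i → f (suc i))

EdgeSet : Graph → Set
EdgeSet G = E G → Bool

size : (G : Graph) → EdgeSet G → ℕ
size G S = count S

-- degree of v within edge set S (graphs are loopless, so each incident edge counts once)
degIn : (G : Graph) → EdgeSet G → V G → ℕ
degIn G S v = count (λ e → S e ∧ incidentᵇ G v e)

degree : (G : Graph) → V G → ℕ
degree G v = degIn G (λ _ → true) v

Cubic : Graph → Set
Cubic G = ∀ v → degree G v ≡ 3

IsEven : (G : Graph) → EdgeSet G → Set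
IsEven G S = ∀ v → ∃ λ k → degIn G S v ≡ 2 * k

data ReachWithout (G : Graph) (f : E G) : V G → V G → Set where
  here : ∀ {u} → ReachWithout G f u u
  step : ∀ {u w} (e : E G) → e ≢ f →
         ((proj₁ (ends G e) ≡ u) × (proj₂ (ends G e) ≡ w)) ⊎
         ((proj₂ (ends G e) ≡ u) × (proj₁ (ends G e) ≡ w)) →
         ∀ {v} → ReachWithout G f w v → ReachWithout G f u v

-- a bridge is an edge whose deletion disconnects its endpoints
-- (equivalently, increases the number of components)
IsBridge : (G : Graph) → E G → Set
IsBridge G e = ¬ ReachWithout G e (proj₁ (ends G e)) (proj₂ (ends G e))

Bridgeless : Graph → Set
Bridgeless G = ∀ e → ¬ IsBridge G e

IsHColoring : (G H : Graph) → (E G → E H) → Set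
IsHColoring G H φ = ∀ (v : V G) → Σ (V H) λ w →
  (∀ e → Incident G v e → Incident H w (φ e)) ×
  (∀ f → Incident H w f → Σ (E G) λ e → Incident G v e × φ e ≡ f)

-- Petersen graph: outer 5-cycle 0..4, spokes i–(i+5), inner pentagram 5-7-9-6-8-5
petersenEnds : Fin 15 → Fin 10 × Fin 10
petersenEnds zero = (# 0 , # 1)
petersenEnds (suc zero) = (# 1 , # 2)
petersenEnds (suc (suc zero)) = (# 2 , # 3)
petersenEnds (suc (suc (suc zero))) = (# 3 , # 4)
petersenEnds (suc (suc (suc (suc zero)))) = (# 4 , # 0)
petersenEnds (suc (suc (suc (suc (suc zero))))) = (# 0 , # 5)
petersenEnds (suc (suc (suc (suc (suc (suc zero)))))) = (# 1 , # 6)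
petersenEnds (suc (suc (suc (suc (suc (suc (suc zero))))))) = (# 2 , # 7)
petersenEnds (suc (suc (suc (suc (suc (suc (suc (suc zero)))))))) = (# 3 , # 8)
petersenEnds (suc (suc (suc (suc (suc (suc (suc (suc (suc zero))))))))) = (# 4 , # 9)
petersenEnds (suc (suc (suc (suc (suc (suc (suc (suc (suc (suc zero)))))))))) = (# 5 , # 7)
petersenEnds (suc (suc (suc (suc (suc (suc (suc (suc (suc (suc (suc zero))))))))))) = (# 7 , # 9)
petersenEnds (suc (suc (suc (suc (suc (suc (suc (suc (suc (suc (suc (suc zero)))))))))))) = (# 9 , # 6)
petersenEnds (suc (suc (suc (suc (suc (suc (suc (suc (suc (suc (suc (suc (suc zero))))))))))))) = (# 6 , # 8)
petersenEnds (suc (suc (suc (suc (suc (suc (suc (suc (suc (suc (suc (suc (suc (suc zero)))))))))))))) = (# 8 , # 5)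

petersenLoopless : ∀ e → proj₁ (petersenEnds e) ≢ proj₂ (petersenEnds e)
petersenLoopless zero ()
petersenLoopless (suc zero) ()
petersenLoopless (suc (suc zero)) ()
petersenLoopless (suc (suc (suc zero))) ()
petersenLoopless (suc (suc (suc (suc zero)))) ()
petersenLoopless (suc (suc (suc (suc (suc zero))))) ()
petersenLoopless (suc (suc (suc (suc (suc (suc zero)))))) ()
petersenLoopless (suc (suc (suc (suc (suc (suc (suc zero))))))) ()
petersenLoopless (suc (suc (suc (suc (suc (suc (suc (suc zero)))))))) ()
petersenLoopless (suc (suc (suc (suc (suc (suc (suc (suc (suc zero))))))))) ()
petersenLoopless (suc (suc (suc (suc (suc (suc (suc (suc (suc (suc zero)))))))))) ()
petersenLoopless (suc (suc (suc (suc (suc (suc (suc (suc (suc (suc (suc zero))))))))))) ()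
petersenLoopless (suc (suc (suc (suc (suc (suc (suc (suc (suc (suc (suc (suc zero)))))))))))) ()
petersenLoopless (suc (suc (suc (suc (suc (suc (suc (suc (suc (suc (suc (suc (suc zero))))))))))))) ()
petersenLoopless (suc (suc (suc (suc (suc (suc (suc (suc (suc (suc (suc (suc (suc (suc zero)))))))))))))) ()

P10 : Graph
P10 = record { n = 10 ; m = 15 ; ends = petersenEnds ; loopless = petersenLoopless }

PetersenColorable : Graph → Set
PetersenColorable G = Σ (E G → E P10) (IsHColoring G P10)

PetersenColoringConjecture : Set
PetersenColoringConjecture = ∀ (G : Graph) → Cubic G → Bridgeless G → PetersenColorable G

-- A Petersen colouring maps the three edges at each vertex of G onto the three edges at a vertex of P10,
-- hence bijectively, so it pulls every double cover of P10 by five even subgraphs back to one of G.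
-- P10 has ten such covers in which every edge lies in the first member exactly six times. Summed over
-- the ten covers, the pulled-back first members have total size 6|E(G)|, so one of them has at least
-- 3/5 of the edges.
module Submission where

open import Defs
open import Data.Nat using (ℕ; zero; suc; _+_; _*_; _≤_; _≡ᵇ_; s≤s⁻¹)
open import Data.Fin using (Fin; zero; suc; toℕ; _≟_)
open import Data.Product using (Σ; _×_; _,_; proj₁; proj₂; ∃)
open import Relation.Binary.PropositionalEquality
  using (_≡_; refl; sym; trans; cong; cong₂; subst; subst₂; module ≡-Reasoning)

import Data.Nat as ℕ
open import Data.Nat.Properties
  using ( ≤-refl; ≤-reflexive; ≤-trans; +-mono-≤; +-monoʳ-≤; *-monoʳ-≤; *-cancelˡ-≤; ≰⇒≥; _≤?_
        ; *-comm; *-assoc; +-*-semiring)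
open import Data.Nat.ListAction using (sum)
open import Data.Nat.ListAction.Properties using (sum-↭)
open import Algebra.Properties.Semiring.Sum +-*-semiring using (sum-syntax; sum-cong-≗; ∑-comm)
open import Data.Fin.Properties using (all?)
open import Data.Bool using (Bool; true; false; if_then_else_; _∧_; T?)
open import Data.Bool.Properties using (T-∨; ∧-identityʳ; ∧-zeroʳ)
open import Data.Unit using (tt)
open import Data.List using (List; []; _∷_; _++_; [_]; map; length; tabulate; allFin; filterᵇ)
open import Data.Bool.ListAction using (any)
open import Data.List.Properties using (map-∘; map-tabulate; length-map)
open import Data.List.Membership.Propositional using (_∈_)
open import Data.List.Membership.Propositional.Properties using (∈-filter⁺; ∈-filter⁻; ∈-allFin; ∈-map⁺; ∈-∃++)
open import Data.List.Relation.Binary.Subset.Propositional using (_⊆_)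
open import Data.List.Relation.Binary.Permutation.Propositional using (_↭_; prep; ↭-refl; module PermutationReasoning)
open import Data.List.Relation.Binary.Permutation.Propositional.Properties using (shift; ∈-resp-↭; ↭-length)
import Data.List.Relation.Binary.Permutation.Propositional.Properties as ↭
import Data.List.Relation.Unary.All as All
open import Data.List.Relation.Unary.Any using (here; there)
open import Data.List.Relation.Unary.Unique.Propositional using (Unique; _∷_)
open import Data.List.Relation.Unary.Unique.Propositional.Properties using (filter⁺; allFin⁺)
open import Data.Sum as Sum using (_⊎_; inj₁; inj₂)
open import Data.Vec using (Vec; lookup; []; _∷_)
open import Function using (_∘_; id; const; Equivalence)
open import Relation.Nullary using (contradiction; yes; no)
open import Relation.Nullary.Decidable using (toWitness; fromWitness; _⊎-dec_)

indicator : Bool → ℕ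
indicator b = if b then 1 else 0

count≡sum-tabulate : ∀ {k} (f : Fin k → Bool) → count f ≡ sum (tabulate (indicator ∘ f))
count≡sum-tabulate {zero}  f = refl
count≡sum-tabulate {suc k} f = cong (indicator (f zero) +_) (count≡sum-tabulate (f ∘ suc))

module _ {A : Set} where

  sum-map-const-1 : (xs : List A) → sum (map (const 1) xs) ≡ length xs
  sum-map-const-1 []       = refl
  sum-map-const-1 (x ∷ xs) = cong suc (sum-map-const-1 xs)

  sum-map-∧≡sum-map-filterᵇ : (S p : A → Bool) (xs : List A) →
    sum (map (λ x → indicator (S x ∧ p x)) xs) ≡ sum (map (indicator ∘ S) (filterᵇ p xs))
  sum-map-∧≡sum-map-filterᵇ S p []       = refl
  sum-map-∧≡sum-map-filterᵇ S p (x ∷ xs) with p x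
  ... | true  = cong₂ _+_ (cong indicator (∧-identityʳ (S x))) (sum-map-∧≡sum-map-filterᵇ S p xs)
  ... | false = cong₂ _+_ (cong indicator (∧-zeroʳ (S x))) (sum-map-∧≡sum-map-filterᵇ S p xs)

  ⊆∧length≤⇒↭ : {xs ys : List A} → Unique ys → ys ⊆ xs → length xs ≤ length ys → xs ↭ ys
  ⊆∧length≤⇒↭ {[]}    {[]}     _ _ _ = ↭-refl
  ⊆∧length≤⇒↭ {_ ∷ _} {[]}     _ _ ()
  ⊆∧length≤⇒↭ {xs}    {y ∷ ys} (y∉ys ∷ ys!) ys⊆xs xs≤ys
    with as , bs , refl ← ∈-∃++ (ys⊆xs (here refl)) = begin
      as ++ [ y ] ++ bs  ↭⟨ shift y as bs ⟩
      y ∷ as ++ bs       ↭⟨ prep y (⊆∧length≤⇒↭ ys! ys⊆as++bs as++bs≤ys) ⟩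
      y ∷ ys             ∎
    where
    open PermutationReasoning
    ys⊆as++bs : ys ⊆ as ++ bs
    ys⊆as++bs z∈ys with ∈-resp-↭ (shift y as bs) (ys⊆xs (there z∈ys))
    ... | here refl = contradiction refl (All.lookup y∉ys z∈ys)
    ... | there z∈as++bs = z∈as++bs
    as++bs≤ys : length (as ++ bs) ≤ length ys
    as++bs≤ys = s≤s⁻¹ (subst (_≤ suc (length ys)) (↭-length (shift y as bs)) xs≤ys)

incidentEdges : (G : Graph) → V G → List (E G)
incidentEdges G v = filterᵇ (incidentᵇ G v) (allFin (m G))

module _ (G : Graph) where

  incidentEdges-unique : ∀ v → Unique (incidentEdges G v)
  incidentEdges-unique v = filter⁺ (T? ∘ incidentᵇ G v) (allFin⁺ (m G))

  ∈-incidentEdges⁺ : ∀ {v e} → Incident G v e → e ∈ incidentEdges G v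
  ∈-incidentEdges⁺ {v} {e} v∈e = ∈-filter⁺ (T? ∘ incidentᵇ G v) (∈-allFin e)
    (Equivalence.from T-∨ (Sum.map (fromWitness {a? = _ ≟ v}) (fromWitness {a? = _ ≟ v}) v∈e))

  ∈-incidentEdges⁻ : ∀ {v e} → e ∈ incidentEdges G v → Incident G v e
  ∈-incidentEdges⁻ {v} {e} e∈ = Sum.map (toWitness {a? = _ ≟ v}) (toWitness {a? = _ ≟ v})
    (Equivalence.to T-∨ (proj₂ (∈-filter⁻ (T? ∘ incidentᵇ G v) {xs = allFin (m G)} e∈)))

  degIn≡sum-incidentEdges : ∀ S v → degIn G S v ≡ sum (map (indicator ∘ S) (incidentEdges G v))
  degIn≡sum-incidentEdges S v = begin
    count S∧v                                      ≡⟨ count≡sum-tabulate S∧v ⟩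
    sum (tabulate (indicator ∘ S∧v))               ≡⟨ cong sum (map-tabulate id (indicator ∘ S∧v)) ⟨
    sum (map (indicator ∘ S∧v) (allFin (m G)))     ≡⟨ sum-map-∧≡sum-map-filterᵇ S (incidentᵇ G v) (allFin (m G)) ⟩
    sum (map (indicator ∘ S) (incidentEdges G v))  ∎
    where
    S∧v : E G → Bool
    S∧v e = S e ∧ incidentᵇ G v e
    open ≡-Reasoning

  degree≡length-incidentEdges : ∀ v → degree G v ≡ length (incidentEdges G v)
  degree≡length-incidentEdges v =
    trans (degIn≡sum-incidentEdges (const true) v) (sum-map-const-1 (incidentEdges G v))

module _ {G H : Graph} {φ : E G → E H} (φ-coloring : IsHColoring G H φ) (v : V G) where

  private
    w : V H
    w = proj₁ (φ-coloring v)

  incidentEdges⊆map-incidentEdges : incidentEdges H w ⊆ map φ (incidentEdges G v)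
  incidentEdges⊆map-incidentEdges f∈
    with e , v∈e , refl ← proj₂ (proj₂ (φ-coloring v)) _ (∈-incidentEdges⁻ H f∈)
    = ∈-map⁺ φ (∈-incidentEdges⁺ G v∈e)

  -- Only surjectivity onto ∂(w) is used; the degree bound then forces φ to be a bijection ∂(v) → ∂(w).
  map-incidentEdges↭incidentEdges : degree G v ≤ degree H w → map φ (incidentEdges G v) ↭ incidentEdges H w
  map-incidentEdges↭incidentEdges deg≤ =
    ⊆∧length≤⇒↭ (incidentEdges-unique H w) incidentEdges⊆map-incidentEdges
      (subst₂ _≤_ (trans (degree≡length-incidentEdges G v) (sym (length-map φ (incidentEdges G v))))
                  (degree≡length-incidentEdges H w) deg≤)

  degIn-∘ : degree G v ≤ degree H w → ∀ C → degIn G (C ∘ φ) v ≡ degIn H C w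
  degIn-∘ deg≤ C = begin
    degIn G (C ∘ φ) v                                      ≡⟨ degIn≡sum-incidentEdges G (C ∘ φ) v ⟩
    sum (map (indicator ∘ C ∘ φ) (incidentEdges G v))      ≡⟨ cong sum (map-∘ (incidentEdges G v)) ⟩
    sum (map (indicator ∘ C) (map φ (incidentEdges G v)))
      ≡⟨ sum-↭ (↭.map⁺ (indicator ∘ C) (map-incidentEdges↭incidentEdges deg≤)) ⟩
    sum (map (indicator ∘ C) (incidentEdges H w))          ≡⟨ degIn≡sum-incidentEdges H C w ⟨
    degIn H C w                                            ∎
    where open ≡-Reasoning

IsEven-∘ : ∀ {G H φ} → Cubic G → Cubic H → IsHColoring G H φ → ∀ {C} → IsEven H C → IsEven G (C ∘ φ)
IsEven-∘ {G} {H} {φ} G-cubic H-cubic φ-coloring {C} C-even v =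
  subst (λ d → ∃ λ k → d ≡ 2 * k) (sym (degIn-∘ {G} {H} {φ} φ-coloring v deg≤ C)) (C-even w)
  where
  w : V H
  w = proj₁ (φ-coloring v)
  deg≤ : degree G v ≤ degree H w
  deg≤ = ≤-reflexive (trans (G-cubic v) (sym (H-cubic w)))

0⊎2⇒even : ∀ {d} → d ≡ 0 ⊎ d ≡ 2 → ∃ λ k → d ≡ 2 * k
0⊎2⇒even (inj₁ refl) = 0 , refl
0⊎2⇒even (inj₂ refl) = 1 , refl

count≡∑ : ∀ {k} (f : Fin k → Bool) → count f ≡ ∑[ i < k ] indicator (f i)
count≡∑ {zero}  f = refl
count≡∑ {suc k} f = cong (indicator (f zero) +_) (count≡∑ (f ∘ suc))

∑-const : ∀ n x → ∑[ i < n ] x ≡ n * x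
∑-const zero    x = refl
∑-const (suc n) x = cong (x +_) (∑-const n x)

∃-≥-average : ∀ {k} (c : Fin (suc k) → ℕ) → ∃ λ j → ∑[ i < suc k ] c i ≤ suc k * c j
∃-≥-average {zero}  c = zero , ≤-refl
∃-≥-average {suc k} c with j , ∑≤ ← ∃-≥-average (c ∘ suc) | c zero ≤? c (suc j)
... | yes c₀≤cⱼ = suc j , +-mono-≤ c₀≤cⱼ ∑≤
... | no  c₀≰cⱼ = zero , +-monoʳ-≤ (c zero) (≤-trans ∑≤ (*-monoʳ-≤ (suc k) (≰⇒≥ c₀≰cⱼ)))

∑-count-∘ : ∀ {k l n} (D : Fin k → Fin n → Bool) {r} → (∀ x → count (λ j → D j x) ≡ r) →
            (φ : Fin l → Fin n) → ∑[ j < k ] count (D j ∘ φ) ≡ l * r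
∑-count-∘ {k} {l} D {r} D-regular φ = begin
  ∑[ j < k ] count (D j ∘ φ)                   ≡⟨ sum-cong-≗ (λ j → count≡∑ (D j ∘ φ)) ⟩
  ∑[ j < k ] ∑[ e < l ] indicator (D j (φ e))  ≡⟨ ∑-comm (λ j e → indicator (D j (φ e))) ⟩
  ∑[ e < l ] ∑[ j < k ] indicator (D j (φ e))  ≡⟨ sum-cong-≗ (λ e → count≡∑ (λ j → D j (φ e))) ⟨
  ∑[ e < l ] count (λ j → D j (φ e))           ≡⟨ sum-cong-≗ (D-regular ∘ φ) ⟩
  ∑[ e < l ] r                                 ≡⟨ ∑-const l r ⟩
  l * r                                        ∎
  where open ≡-Reasoning

∃-dense-preimage : ∀ {k l n} (D : Fin (suc k) → Fin n → Bool) {r} → (∀ x → count (λ j → D j x) ≡ r) →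
                   (φ : Fin l → Fin n) → ∃ λ j → l * r ≤ suc k * count (D j ∘ φ)
∃-dense-preimage {k} D D-regular φ
  with j , ∑≤ ← ∃-≥-average (λ j → count (D j ∘ φ))
  = j , subst (_≤ suc k * count (D j ∘ φ)) (∑-count-∘ D D-regular φ) ∑≤

-- Ten double covers of P10 by five even subgraphs, each listed by edge numbers as in petersenEnds.
-- Covers 0–4 are the images of cover 0 under the rotation v ↦ v + 1 of both 5-cycles, covers 5–9 those
-- of cover 5. Their first members are 9-cycles meeting the outer cycle, the spokes and the pentagram in
-- 4, 2, 3 and in 2, 4, 3 edges respectively, so every edge lies in the first member of exactly six covers.
petersenCoverTable : Vec (Vec (List ℕ) 5) 10
petersenCoverTable =
  ( (0 ∷ 1 ∷ 2 ∷ 3 ∷ 5 ∷ 9 ∷ 12 ∷ 13 ∷ 14 ∷ []) ∷ (1 ∷ 6 ∷ 7 ∷ 11 ∷ 12 ∷ []) ∷ (2 ∷ 7 ∷ 8 ∷ 10 ∷ 14 ∷ [])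
  ∷ (4 ∷ 5 ∷ 9 ∷ 10 ∷ 11 ∷ []) ∷ (0 ∷ 3 ∷ 4 ∷ 6 ∷ 8 ∷ 13 ∷ []) ∷ [])
  ∷ ( (1 ∷ 2 ∷ 3 ∷ 4 ∷ 5 ∷ 6 ∷ 10 ∷ 11 ∷ 12 ∷ []) ∷ (2 ∷ 7 ∷ 8 ∷ 10 ∷ 14 ∷ []) ∷ (3 ∷ 8 ∷ 9 ∷ 12 ∷ 13 ∷ [])
    ∷ (0 ∷ 5 ∷ 6 ∷ 13 ∷ 14 ∷ []) ∷ (0 ∷ 1 ∷ 4 ∷ 7 ∷ 9 ∷ 11 ∷ []) ∷ [])
  ∷ ( (0 ∷ 2 ∷ 3 ∷ 4 ∷ 6 ∷ 7 ∷ 10 ∷ 13 ∷ 14 ∷ []) ∷ (3 ∷ 8 ∷ 9 ∷ 12 ∷ 13 ∷ []) ∷ (4 ∷ 5 ∷ 9 ∷ 10 ∷ 11 ∷ [])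
    ∷ (1 ∷ 6 ∷ 7 ∷ 11 ∷ 12 ∷ []) ∷ (0 ∷ 1 ∷ 2 ∷ 5 ∷ 8 ∷ 14 ∷ []) ∷ [])
  ∷ ( (0 ∷ 1 ∷ 3 ∷ 4 ∷ 7 ∷ 8 ∷ 11 ∷ 12 ∷ 13 ∷ []) ∷ (4 ∷ 5 ∷ 9 ∷ 10 ∷ 11 ∷ []) ∷ (0 ∷ 5 ∷ 6 ∷ 13 ∷ 14 ∷ [])
    ∷ (2 ∷ 7 ∷ 8 ∷ 10 ∷ 14 ∷ []) ∷ (1 ∷ 2 ∷ 3 ∷ 6 ∷ 9 ∷ 12 ∷ []) ∷ [])
  ∷ ( (0 ∷ 1 ∷ 2 ∷ 4 ∷ 8 ∷ 9 ∷ 10 ∷ 11 ∷ 14 ∷ []) ∷ (0 ∷ 5 ∷ 6 ∷ 13 ∷ 14 ∷ []) ∷ (1 ∷ 6 ∷ 7 ∷ 11 ∷ 12 ∷ [])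
    ∷ (3 ∷ 8 ∷ 9 ∷ 12 ∷ 13 ∷ []) ∷ (2 ∷ 3 ∷ 4 ∷ 5 ∷ 7 ∷ 10 ∷ []) ∷ [])
  ∷ ( (0 ∷ 2 ∷ 5 ∷ 6 ∷ 7 ∷ 8 ∷ 11 ∷ 12 ∷ 14 ∷ []) ∷ (0 ∷ 1 ∷ 2 ∷ 3 ∷ 4 ∷ []) ∷ (3 ∷ 8 ∷ 9 ∷ 12 ∷ 13 ∷ [])
    ∷ (4 ∷ 5 ∷ 9 ∷ 10 ∷ 11 ∷ []) ∷ (1 ∷ 6 ∷ 7 ∷ 10 ∷ 13 ∷ 14 ∷ []) ∷ [])
  ∷ ( (1 ∷ 3 ∷ 6 ∷ 7 ∷ 8 ∷ 9 ∷ 10 ∷ 12 ∷ 14 ∷ []) ∷ (0 ∷ 1 ∷ 2 ∷ 3 ∷ 4 ∷ []) ∷ (4 ∷ 5 ∷ 9 ∷ 10 ∷ 11 ∷ [])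
    ∷ (0 ∷ 5 ∷ 6 ∷ 13 ∷ 14 ∷ []) ∷ (2 ∷ 7 ∷ 8 ∷ 11 ∷ 12 ∷ 13 ∷ []) ∷ [])
  ∷ ( (2 ∷ 4 ∷ 5 ∷ 7 ∷ 8 ∷ 9 ∷ 10 ∷ 12 ∷ 13 ∷ []) ∷ (0 ∷ 1 ∷ 2 ∷ 3 ∷ 4 ∷ []) ∷ (0 ∷ 5 ∷ 6 ∷ 13 ∷ 14 ∷ [])
    ∷ (1 ∷ 6 ∷ 7 ∷ 11 ∷ 12 ∷ []) ∷ (3 ∷ 8 ∷ 9 ∷ 10 ∷ 11 ∷ 14 ∷ []) ∷ [])
  ∷ ( (0 ∷ 3 ∷ 5 ∷ 6 ∷ 8 ∷ 9 ∷ 10 ∷ 11 ∷ 13 ∷ []) ∷ (0 ∷ 1 ∷ 2 ∷ 3 ∷ 4 ∷ []) ∷ (1 ∷ 6 ∷ 7 ∷ 11 ∷ 12 ∷ [])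
    ∷ (2 ∷ 7 ∷ 8 ∷ 10 ∷ 14 ∷ []) ∷ (4 ∷ 5 ∷ 9 ∷ 12 ∷ 13 ∷ 14 ∷ []) ∷ [])
  ∷ ( (1 ∷ 4 ∷ 5 ∷ 6 ∷ 7 ∷ 9 ∷ 11 ∷ 13 ∷ 14 ∷ []) ∷ (0 ∷ 1 ∷ 2 ∷ 3 ∷ 4 ∷ []) ∷ (2 ∷ 7 ∷ 8 ∷ 10 ∷ 14 ∷ [])
    ∷ (3 ∷ 8 ∷ 9 ∷ 12 ∷ 13 ∷ []) ∷ (0 ∷ 5 ∷ 6 ∷ 10 ∷ 11 ∷ 12 ∷ []) ∷ [])
  ∷ []

petersenCover : Fin 10 → Fin 5 → EdgeSet P10
petersenCover j i f = any (toℕ f ≡ᵇ_) (lookup (lookup petersenCoverTable j) i)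

P10-cubic : Cubic P10
P10-cubic = toWitness {a? = all? λ v → degree P10 v ℕ.≟ 3} tt

petersenCover-degree : ∀ j i v → degIn P10 (petersenCover j i) v ≡ 0 ⊎ degIn P10 (petersenCover j i) v ≡ 2
petersenCover-degree = toWitness {a? = all? λ j → all? λ i → all? λ v →
  (degIn P10 (petersenCover j i) v ℕ.≟ 0) ⊎-dec (degIn P10 (petersenCover j i) v ℕ.≟ 2)} tt

petersenCover-even : ∀ j i → IsEven P10 (petersenCover j i)
petersenCover-even j i v = 0⊎2⇒even (petersenCover-degree j i v)

petersenCover-double : ∀ j f → count (λ i → petersenCover j i f) ≡ 2
petersenCover-double = toWitness {a? = all? λ j → all? λ f → count (λ i → petersenCover j i f) ℕ.≟ 2} tt

petersenCover-zero-regular : ∀ f → count (λ j → petersenCover j zero f) ≡ 6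
petersenCover-zero-regular = toWitness {a? = all? λ f → count (λ j → petersenCover j zero f) ℕ.≟ 6} tt

theorem3p5 : PetersenColoringConjecture →
    ∀ (G : Graph) → Cubic G → Bridgeless G →
    Σ (Fin 5 → EdgeSet G) λ Es →
      (∀ i → IsEven G (Es i)) ×
      (∀ (e : E G) → count (λ i → Es i e) ≡ 2) ×
      (3 * m G ≤ 5 * size G (Es zero))
theorem3p5 pcc G G-cubic G-bridgeless =
  let φ , φ-coloring = pcc G G-cubic G-bridgeless
      j , 6m≤10|E₀| = ∃-dense-preimage (λ j → petersenCover j zero) petersenCover-zero-regular φ
  in (λ i → petersenCover j i ∘ φ)
   , (λ i → IsEven-∘ {G} {P10} {φ} G-cubic P10-cubic φ-coloring {petersenCover j i} (petersenCover-even j i))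
   , (λ e → petersenCover-double j (φ e))
   , halve (m G) (size G (petersenCover j zero ∘ φ)) 6m≤10|E₀|
  where
  halve : ∀ a b → a * 6 ≤ 10 * b → 3 * a ≤ 5 * b
  halve a b = *-cancelˡ-≤ 2 ∘ subst₂ _≤_ (trans (*-comm a 6) (*-assoc 2 3 a)) (*-assoc 2 5 b)
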